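{- Let $n\geq 2$ be an integer and $G_n=K_2\square K_2\square K_n$. Then $\mathrm{rn}(G_n)\geq 6n-1$.
   Context: $K_n$ is the complete graph on $n$ vertices and $\square$ the Cartesian product of graphs. For a simple connected graph $G$, a map $f:V(G)\to\mathbb{Z}_+$ is a radio labeling if $|f(u)-f(v)|\geq \mathrm{diam}(G)+1-d(u,v)$ for all distinct $u,v\in V(G)$; its span is the largest value of $f$, and the radio number $\mathrm{rn}(G)$ is the minimum span over all radio labelings of $G$. -}

module Defs where

open import Level using (0ℓ)
open import Data.Nat using (ℕ; zero; suc; _+_; _≤_; ∣_-_∣)
open import Data.Fin using (Fin)
open import Data.Product using (_×_; Σ; ∃; ∃-syntax; _,_)
open import Data.Sum using (_⊎_)
open import Relation.Binary.PropositionalEquality using (_≡_; _≢_)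

record Graph : Set₁ where
  field
    V   : Set
    Adj : V → V → Set
open Graph public

K : ℕ → Graph
K n = record { V = Fin n ; Adj = λ i j → i ≢ j }

_□_ : Graph → Graph → Graph
G □ H = record
  { V   = V G × V H
  ; Adj = λ { (g , h) (g' , h') →
              (g ≡ g' × Adj H h h') ⊎ (Adj G g g' × h ≡ h') } }
infixr 6 _□_

data Walk (G : Graph) : V G → V G → ℕ → Set where
  nil  : ∀ {u} → Walk G u u 0
  cons : ∀ {u w v k} → Adj G u w → Walk G w v k → Walk G u v (suc k)

IsDist : (G : Graph) → V G → V G → ℕ → Set
IsDist G u v d = Walk G u v d × (∀ k → Walk G u v k → d ≤ k)

IsDiam : Graph → ℕ → Set
IsDiam G D =
  (∀ u v → ∃[ d ] (IsDist G u v d × d ≤ D)) ×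
  (∃[ u ] ∃[ v ] IsDist G u v D)

IsRadioLabeling : (G : Graph) → ℕ → (V G → ℕ) → Set
IsRadioLabeling G D f =
  (∀ v → 1 ≤ f v) ×
  (∀ u v → u ≢ v → ∀ d → IsDist G u v d → D + 1 ≤ ∣ f u - f v ∣ + d)

IsSpan : (G : Graph) → (V G → ℕ) → ℕ → Set
IsSpan G f s = (∀ v → f v ≤ s) × (∃[ v ] f v ≡ s)

Gn : ℕ → Graph
Gn n = K 2 □ K 2 □ K n

-- Distances in K₂ □ K₂ □ Kₙ are Hamming distances, so the diameter is 3 and a radio labeling f
-- satisfies |f u − f v| + d(u,v) ≥ 4.  Vertices carrying three consecutive labels k, k+1, k+2
-- would be pairwise at distances at least 3, 3 and 2, a total of 8; but any three vertices have
-- total distance at most 7, since two of them agree in each K₂ coordinate.  So f is injective and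
-- uses at most two of any three consecutive values; hence at most (2m+2)/3 vertices have label
-- ≤ m, and taking m to be the span, 12n ≤ 2 span + 2.

module Submission where

open import Defs
open import Data.Nat using (ℕ; _≤_; _*_; _∸_; zero; suc; _+_; _<_; z≤n; s≤s; s≤s⁻¹; ∣_-_∣; _≤?_)
open import Data.Nat.Properties
  using (≤-refl; ≤-trans; ≤-antisym; n≤1+n; m≤m+n; m≤n+m; +-suc; +-mono-≤; +-monoˡ-≤; +-monoʳ-≤;
         *-monoʳ-≤; *-distribˡ-+; *-cancelˡ-≤; ∸-monoˡ-≤; m≤n⇒m<n∨m≡n; m≡n⇒∣m-n∣≡0; ∣n-n∣≡0;
         m≤n⇒∣m-n∣≡n∸m; m+n∸n≡m; 1+n≰n; 0≢1+n; module ≤-Reasoning)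
  renaming (_≟_ to _≟ℕ_)
open import Data.Nat.Tactic.RingSolver using (solve-∀)
open import Data.Fin using (Fin; zero; suc; _≟_)
open import Data.Product using (_×_; ∃; ∃₂; _,_; proj₁; proj₂)
open import Data.Sum using (inj₁; inj₂; map₁)
open import Data.Empty using (⊥; ⊥-elim)
open import Data.List using (List; []; _∷_; _++_; length; filter; cartesianProduct; allFin; map)
open import Data.List.Properties
  using (length-map; length-++; length-tabulate; filter-all; filter-none; filter-accept)
open import Data.List.Membership.Propositional using (_∈_)
open import Data.List.Membership.Propositional.Properties using (∈-filter⁻)
open import Data.List.Relation.Unary.Any using (here; there)
open import Data.List.Relation.Unary.All using (_∷_; universal)
open import Data.List.Relation.Unary.AllPairs using ([]; _∷_)
open import Data.List.Relation.Unary.Unique.Propositional using (Unique)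
open import Data.List.Relation.Unary.Unique.Propositional.Properties
  using (cartesianProduct⁺; allFin⁺; filter⁺)
open import Relation.Nullary using (yes; no; ¬_)
open import Relation.Unary using (Pred; Decidable; _⊆_; _∪_)
open import Relation.Binary.PropositionalEquality
  using (_≡_; _≢_; refl; sym; trans; cong; cong₂; subst; module ≡-Reasoning)

isDist-unique : ∀ {G u v d d′} → IsDist G u v d → IsDist G u v d′ → d ≡ d′
isDist-unique (w , min) (w′ , min′) = ≤-antisym (min _ w′) (min′ _ w)

_++ʷ_ : ∀ {G u w v k l} → Walk G u w k → Walk G w v l → Walk G u v (k + l)
nil      ++ʷ q = q
cons a p ++ʷ q = cons a (p ++ʷ q)

δ : ∀ {m} → Fin m → Fin m → ℕ
δ i j with i ≟ j
... | yes _ = 0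
... | no  _ = 1

δ≤1 : ∀ {m} (i j : Fin m) → δ i j ≤ 1
δ≤1 i j with i ≟ j
... | yes _ = z≤n
... | no  _ = s≤s z≤n

K-isDist : ∀ {m} (i j : Fin m) → IsDist (K m) i j (δ i j)
K-isDist i j with i ≟ j
... | yes refl = nil , λ _ _ → z≤n
... | no  i≢j  = cons i≢j nil , atLeastOne
  where
  atLeastOne : ∀ k → Walk (K _) i j k → 1 ≤ k
  atLeastOne _ nil        = ⊥-elim (i≢j refl)
  atLeastOne _ (cons _ _) = s≤s z≤n

module _ {G H : Graph} where

  □-walkˡ : ∀ {g g′ h k} → Walk G g g′ k → Walk (G □ H) (g , h) (g′ , h) k
  □-walkˡ nil        = nil
  □-walkˡ (cons a w) = cons (inj₂ (a , refl)) (□-walkˡ w)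

  □-walkʳ : ∀ {g h h′ k} → Walk H h h′ k → Walk (G □ H) (g , h) (g , h′) k
  □-walkʳ nil        = nil
  □-walkʳ (cons a w) = cons (inj₁ (refl , a)) (□-walkʳ w)

  □-walk-split : ∀ {g g′ h h′ k} → Walk (G □ H) (g , h) (g′ , h′) k →
                 ∃₂ λ i j → Walk G g g′ i × Walk H h h′ j × i + j ≡ k
  □-walk-split nil = 0 , 0 , nil , nil , refl
  □-walk-split (cons (inj₁ (refl , a)) w) with □-walk-split w
  ... | i , j , wG , wH , refl = i , suc j , wG , cons a wH , +-suc i j
  □-walk-split (cons (inj₂ (a , refl)) w) with □-walk-split w
  ... | i , j , wG , wH , refl = suc i , j , cons a wG , wH , refl

  □-isDist : ∀ {g g′ h h′ d e} → IsDist G g g′ d → IsDist H h h′ e →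
             IsDist (G □ H) (g , h) (g′ , h′) (d + e)
  □-isDist {d = d} {e} (wG , minG) (wH , minH) = □-walkˡ wG ++ʷ □-walkʳ wH , min
    where
    min : ∀ k → Walk (G □ H) _ _ k → d + e ≤ k
    min k w with □-walk-split w
    ... | i , j , wG′ , wH′ , refl = +-mono-≤ (minG i wG′) (minH j wH′)

hamming : ∀ {a b c} → Fin a × Fin b × Fin c → Fin a × Fin b × Fin c → ℕ
hamming (x , y , z) (x′ , y′ , z′) = δ x x′ + (δ y y′ + δ z z′)

K□K□K-isDist : ∀ {a b c} (u v : V (K a □ K b □ K c)) → IsDist (K a □ K b □ K c) u v (hamming u v)
K□K□K-isDist (x , y , z) (x′ , y′ , z′) =
  □-isDist (K-isDist x x′) (□-isDist (K-isDist y y′) (K-isDist z z′))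

hamming≤3 : ∀ {a b c} (u v : Fin a × Fin b × Fin c) → hamming u v ≤ 3
hamming≤3 (x , y , z) (x′ , y′ , z′) = +-mono-≤ (δ≤1 x x′) (+-mono-≤ (δ≤1 y y′) (δ≤1 z z′))

δ-sum₃≤3 : ∀ {m} (x y z : Fin m) → δ x y + δ y z + δ x z ≤ 3
δ-sum₃≤3 x y z = +-mono-≤ (+-mono-≤ (δ≤1 x y) (δ≤1 y z)) (δ≤1 x z)

-- Among three elements of Fin 2 two coincide.
δ-sum₃≤2 : (x y z : Fin 2) → δ x y + δ y z + δ x z ≤ 2
δ-sum₃≤2 zero       zero       zero       = z≤n
δ-sum₃≤2 zero       zero       (suc zero) = ≤-refl
δ-sum₃≤2 zero       (suc zero) zero       = ≤-refl
δ-sum₃≤2 zero       (suc zero) (suc zero) = ≤-refl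
δ-sum₃≤2 (suc zero) zero       zero       = ≤-refl
δ-sum₃≤2 (suc zero) zero       (suc zero) = ≤-refl
δ-sum₃≤2 (suc zero) (suc zero) zero       = ≤-refl
δ-sum₃≤2 (suc zero) (suc zero) (suc zero) = z≤n

hamming-sum₃≤7 : ∀ {n} (u v w : Fin 2 × Fin 2 × Fin n) → hamming u v + hamming v w + hamming u w ≤ 7
hamming-sum₃≤7 (x₁ , y₁ , z₁) (x₂ , y₂ , z₂) (x₃ , y₃ , z₃) =
  subst (_≤ 7) (regroup (δ x₁ x₂) (δ y₁ y₂) (δ z₁ z₂) (δ x₂ x₃) (δ y₂ y₃) (δ z₂ z₃) (δ x₁ x₃) (δ y₁ y₃) (δ z₁ z₃))
    (+-mono-≤ (+-mono-≤ (δ-sum₃≤2 x₁ x₂ x₃) (δ-sum₃≤2 y₁ y₂ y₃)) (δ-sum₃≤3 z₁ z₂ z₃))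
  where
  regroup : ∀ a₁ b₁ c₁ a₂ b₂ c₂ a₃ b₃ c₃ →
    (a₁ + a₂ + a₃) + (b₁ + b₂ + b₃) + (c₁ + c₂ + c₃) ≡ (a₁ + (b₁ + c₁)) + (a₂ + (b₂ + c₂)) + (a₃ + (b₃ + c₃))
  regroup = solve-∀

length-cartesianProduct : ∀ {A B : Set} (xs : List A) (ys : List B) →
                          length (cartesianProduct xs ys) ≡ length xs * length ys
length-cartesianProduct []       ys = refl
length-cartesianProduct (x ∷ xs) ys = begin
  length (map (x ,_) ys ++ cartesianProduct xs ys)          ≡⟨ length-++ (map (x ,_) ys) ⟩
  length (map (x ,_) ys) + length (cartesianProduct xs ys)  ≡⟨ cong₂ _+_ (length-map (x ,_) ys) (length-cartesianProduct xs ys) ⟩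
  length ys + length xs * length ys                         ∎
  where open ≡-Reasoning

module _ {a p} {A : Set a} {P : Pred A p} (P? : Decidable P) where

  length-filter-∷ : ∀ x xs → length (filter P? xs) ≤ length (filter P? (x ∷ xs))
  length-filter-∷ x xs with P? x
  ... | yes _ = n≤1+n _
  ... | no  _ = ≤-refl

  length-filter-accept : ∀ {x xs} → P x → length (filter P? (x ∷ xs)) ≡ suc (length (filter P? xs))
  length-filter-accept px = cong length (filter-accept P? px)

module _ {a p q r} {A : Set a} {P : Pred A p} {Q : Pred A q} {R : Pred A r} where

  length-filter-∪ : (P? : Decidable P) (Q? : Decidable Q) (R? : Decidable R) → P ⊆ Q ∪ R →
                    ∀ xs → length (filter P? xs) ≤ length (filter Q? xs) + length (filter R? xs)
  length-filter-∪ P? Q? R? P⊆Q∪R [] = z≤n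
  length-filter-∪ P? Q? R? P⊆Q∪R (x ∷ xs) with ih ← length-filter-∪ P? Q? R? P⊆Q∪R xs | P? x
  ... | no _ = ≤-trans ih (+-mono-≤ (length-filter-∷ Q? x xs) (length-filter-∷ R? x xs))
  ... | yes px with P⊆Q∪R px
  ...   | inj₁ qx = begin
    suc (length (filter P? xs))                                 ≤⟨ s≤s ih ⟩
    suc (length (filter Q? xs) + length (filter R? xs))         ≤⟨ s≤s (+-monoʳ-≤ _ (length-filter-∷ R? x xs)) ⟩
    suc (length (filter Q? xs)) + length (filter R? (x ∷ xs))   ≡⟨ cong (_+ _) (length-filter-accept Q? qx) ⟨
    length (filter Q? (x ∷ xs)) + length (filter R? (x ∷ xs))   ∎
    where open ≤-Reasoning
  ...   | inj₂ rx = begin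
    suc (length (filter P? xs))                                 ≤⟨ s≤s ih ⟩
    suc (length (filter Q? xs) + length (filter R? xs))         ≤⟨ s≤s (+-monoˡ-≤ _ (length-filter-∷ Q? x xs)) ⟩
    suc (length (filter Q? (x ∷ xs)) + length (filter R? xs))   ≡⟨ +-suc _ _ ⟨
    length (filter Q? (x ∷ xs)) + suc (length (filter R? xs))   ≡⟨ cong (_ +_) (length-filter-accept R? rx) ⟨
    length (filter Q? (x ∷ xs)) + length (filter R? (x ∷ xs))   ∎
    where open ≤-Reasoning

unique-length≤1 : ∀ {a} {A : Set a} {xs : List A} → Unique xs → (∀ {x y} → x ∈ xs → y ∈ xs → ¬ x ≢ y) →
                  length xs ≤ 1
unique-length≤1 []                  _     = z≤n
unique-length≤1 (_ ∷ [])            _     = s≤s z≤n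
unique-length≤1 ((x≢y ∷ _) ∷ _ ∷ _) no-two = ⊥-elim (no-two (here refl) (there (here refl)) x≢y)

module _ {a p} {A : Set a} {P : Pred A p} (P? : Decidable P) where

  ∈-filter⇒P : ∀ {x} xs → x ∈ filter P? xs → P x
  ∈-filter⇒P xs x∈ = proj₂ (∈-filter⁻ P? {xs = xs} x∈)

  length-filter≤1 : ∀ {xs} → Unique xs → (∀ {x y} → P x → P y → ¬ x ≢ y) → length (filter P? xs) ≤ 1
  length-filter≤1 {xs} xs! P-unique =
    unique-length≤1 (filter⁺ P? xs!) λ x∈ y∈ → P-unique (∈-filter⇒P xs x∈) (∈-filter⇒P xs y∈)

  length-filter>0⇒∃ : ∀ xs → 0 < length (filter P? xs) → ∃ P
  length-filter>0⇒∃ xs _ with filter P? xs in eq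
  ... | y ∷ _ = y , ∈-filter⇒P xs (subst (y ∈_) (sym eq) (here refl))

sum₃≤2 : ∀ {a b c} → a ≤ 1 → b ≤ 1 → c ≤ 1 → (1 ≤ a → 1 ≤ b → 1 ≤ c → ⊥) → a + b + c ≤ 2
sum₃≤2 z≤n               b≤1               c≤1               _   = +-mono-≤ b≤1 c≤1
sum₃≤2 (s≤s z≤n)         z≤n               c≤1               _   = s≤s c≤1
sum₃≤2 (s≤s z≤n)         (s≤s z≤n)         z≤n               _   = ≤-refl
sum₃≤2 (s≤s z≤n)         (s≤s z≤n)         (s≤s z≤n)         all = ⊥-elim (all ≤-refl ≤-refl ≤-refl)

-- Below, c m counts the vertices with label ≤ m and e k those with label k.
module _ (c e : ℕ → ℕ) (c-zero : c 0 ≡ 0) (c-suc : ∀ m → c (suc m) ≤ c m + e (suc m))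
         (e≤1 : ∀ k → e k ≤ 1) (e-window : ∀ k → e k + e (suc k) + e (suc (suc k)) ≤ 2) where

  private
    c-one : c 1 ≤ e 1
    c-one = subst (λ z → c 1 ≤ z + e 1) c-zero (c-suc 0)

    c-two : c 2 ≤ e 1 + e 2
    c-two = ≤-trans (c-suc 1) (+-monoˡ-≤ _ c-one)

    c-suc₃ : ∀ m → c (3 + m) ≤ c m + (e (1 + m) + e (2 + m) + e (3 + m))
    c-suc₃ m = begin
      c (3 + m)                                    ≤⟨ c-suc (2 + m) ⟩
      c (2 + m) + e (3 + m)                        ≤⟨ +-monoˡ-≤ _ (c-suc (1 + m)) ⟩
      c (1 + m) + e (2 + m) + e (3 + m)            ≤⟨ +-monoˡ-≤ _ (+-monoˡ-≤ _ (c-suc m)) ⟩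
      c m + e (1 + m) + e (2 + m) + e (3 + m)      ≡⟨ regroup (c m) (e (1 + m)) (e (2 + m)) (e (3 + m)) ⟩
      c m + (e (1 + m) + e (2 + m) + e (3 + m))    ∎
      where
      open ≤-Reasoning
      regroup : ∀ a b c d → a + b + c + d ≡ a + (b + c + d)
      regroup = solve-∀

  three-window-bound : ∀ m → 3 * c m ≤ 2 * suc m
  three-window-bound 0 rewrite c-zero = z≤n
  three-window-bound 1 = ≤-trans (*-monoʳ-≤ 3 (≤-trans c-one (e≤1 1))) (n≤1+n 3)
  three-window-bound 2 = *-monoʳ-≤ 3 (≤-trans c-two (≤-trans (m≤m+n _ (e 3)) (e-window 1)))
  three-window-bound (suc (suc (suc m))) = begin
    3 * c (3 + m)        ≤⟨ *-monoʳ-≤ 3 (≤-trans (c-suc₃ m) (+-monoʳ-≤ (c m) (e-window (suc m)))) ⟩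
    3 * (c m + 2)        ≡⟨ *-distribˡ-+ 3 (c m) 2 ⟩
    3 * c m + 6          ≤⟨ +-monoˡ-≤ 6 (three-window-bound m) ⟩
    2 * suc m + 6        ≡⟨ shift m ⟩
    2 * suc (3 + m)      ∎
    where
    open ≤-Reasoning
    shift : ∀ m → 2 * suc m + 6 ≡ 2 * suc (3 + m)
    shift = solve-∀

∣m-n+m∣≡n : ∀ n k → ∣ k - n + k ∣ ≡ n
∣m-n+m∣≡n n k = trans (m≤n⇒∣m-n∣≡n∸m (m≤n+m k n)) (m+n∸n≡m n k)

module RadioLabelingOfGn {n} (f : V (Gn n) → ℕ) (f-pos : ∀ v → 1 ≤ f v)
       (f-gap : ∀ {u v} → u ≢ v → 4 ≤ ∣ f u - f v ∣ + hamming u v) where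

  f-injective : ∀ {u v} → u ≢ v → f u ≢ f v
  f-injective {u} {v} u≢v fu≡fv = 1+n≰n (≤-trans (f-gap u≢v) gap+distance≤3)
    where
    gap+distance≤3 : ∣ f u - f v ∣ + hamming u v ≤ 3
    gap+distance≤3 = subst (λ g → g + hamming u v ≤ 3) (sym (m≡n⇒∣m-n∣≡0 fu≡fv)) (hamming≤3 u v)

  no-consecutive-labels : ∀ {k x y z} → f x ≡ k → f y ≡ suc k → f z ≡ suc (suc k) → ⊥
  no-consecutive-labels {k} {x} {y} {z} fx fy fz = 1+n≰n (begin
    8                                          ≤⟨ +-mono-≤ (+-mono-≤ xy yz) xz ⟩
    hamming x y + hamming y z + hamming x z    ≤⟨ hamming-sum₃≤7 x y z ⟩
    7                                          ∎)
    where
    open ≤-Reasoning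
    gap : ∀ {u v} m {l} → f u ≡ l → f v ≡ m + l → ∣ f u - f v ∣ ≡ m
    gap m {l} fu fv = trans (cong₂ ∣_-_∣ fu fv) (∣m-n+m∣≡n m l)
    apart : ∀ {u v} g → ∣ f u - f v ∣ ≡ suc g → 4 ≤ suc g + hamming u v
    apart {u} {v} g gap≡ = subst (λ d → 4 ≤ d + hamming u v) gap≡ (f-gap u≢v)
      where
      u≢v : u ≢ v
      u≢v refl = 0≢1+n (trans (sym (∣n-n∣≡0 (f u))) gap≡)
    xy : 3 ≤ hamming x y
    xy = s≤s⁻¹ (apart 0 (gap 1 fx fy))
    yz : 3 ≤ hamming y z
    yz = s≤s⁻¹ (apart 0 (gap 1 fy fz))
    xz : 2 ≤ hamming x z
    xz = s≤s⁻¹ (s≤s⁻¹ (apart 1 (gap 2 fx fz)))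

  vertices : List (V (Gn n))
  vertices = cartesianProduct (allFin 2) (cartesianProduct (allFin 2) (allFin n))

  vertices-unique : Unique vertices
  vertices-unique = cartesianProduct⁺ (allFin⁺ 2) (cartesianProduct⁺ (allFin⁺ 2) (allFin⁺ n))

  length-vertices : length vertices ≡ 2 * (2 * n)
  length-vertices = begin
    length vertices
      ≡⟨ length-cartesianProduct (allFin 2) (cartesianProduct (allFin 2) (allFin n)) ⟩
    2 * length (cartesianProduct (allFin 2) (allFin n))
      ≡⟨ cong (2 *_) (length-cartesianProduct (allFin 2) (allFin n)) ⟩
    2 * (2 * length (allFin n))
      ≡⟨ cong (λ l → 2 * (2 * l)) (length-tabulate {n = n} (λ i → i)) ⟩
    2 * (2 * n)
      ∎
    where open ≡-Reasoning

  atMost : ℕ → ℕ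
  atMost m = length (filter (λ v → f v ≤? m) vertices)

  labelled : ℕ → ℕ
  labelled k = length (filter (λ v → f v ≟ℕ k) vertices)

  atMost-zero : atMost 0 ≡ 0
  atMost-zero = cong length (filter-none (λ v → f v ≤? 0) (universal no-zero-label vertices))
    where
    no-zero-label : ∀ v → ¬ f v ≤ 0
    no-zero-label v fv≤0 = 1+n≰n (≤-trans (f-pos v) fv≤0)

  atMost-suc : ∀ m → atMost (suc m) ≤ atMost m + labelled (suc m)
  atMost-suc m = length-filter-∪ (λ v → f v ≤? suc m) (λ v → f v ≤? m) (λ v → f v ≟ℕ suc m)
                   (λ fv≤1+m → map₁ s≤s⁻¹ (m≤n⇒m<n∨m≡n fv≤1+m)) vertices

  labelled≤1 : ∀ k → labelled k ≤ 1
  labelled≤1 k = length-filter≤1 (λ v → f v ≟ℕ k) vertices-unique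
                   (λ fu fv u≢v → f-injective u≢v (trans fu (sym fv)))

  labelled-window : ∀ k → labelled k + labelled (suc k) + labelled (suc (suc k)) ≤ 2
  labelled-window k = sum₃≤2 (labelled≤1 k) (labelled≤1 (suc k)) (labelled≤1 (suc (suc k))) all-used
    where
    all-used : 1 ≤ labelled k → 1 ≤ labelled (suc k) → 1 ≤ labelled (suc (suc k)) → ⊥
    all-used p q r
      with length-filter>0⇒∃ _ vertices p | length-filter>0⇒∃ _ vertices q | length-filter>0⇒∃ _ vertices r
    ... | _ , fx | _ , fy | _ , fz = no-consecutive-labels fx fy fz

  span-bound : ∀ {s} → IsSpan (Gn n) f s → 6 * n ≤ suc s
  span-bound {s} (f≤s , _) = *-cancelˡ-≤ 2 (begin
    2 * (6 * n)             ≡⟨ regroup n ⟩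
    3 * (2 * (2 * n))       ≡⟨ cong (3 *_) atMost-span ⟨
    3 * atMost s            ≤⟨ three-window-bound atMost labelled atMost-zero atMost-suc labelled≤1 labelled-window s ⟩
    2 * suc s               ∎)
    where
    open ≤-Reasoning
    regroup : ∀ n → 2 * (6 * n) ≡ 3 * (2 * (2 * n))
    regroup = solve-∀
    atMost-span : atMost s ≡ 2 * (2 * n)
    atMost-span = trans (cong length (filter-all (λ v → f v ≤? s) (universal f≤s vertices))) length-vertices

Gn-diam≥3 : ∀ {n D} → 2 ≤ n → IsDiam (Gn n) D → 3 ≤ D
Gn-diam≥3 {D = D} (s≤s (s≤s _)) (eccentricities , _)
  with eccentricities (zero , zero , zero) (suc zero , suc zero , suc zero)
... | d , d-dist , d≤D = subst (_≤ D) (isDist-unique d-dist (K□K□K-isDist _ _)) d≤D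

Gn-radio-gap : ∀ {n D f} → 3 ≤ D → IsRadioLabeling (Gn n) D f →
               ∀ {u v} → u ≢ v → 4 ≤ ∣ f u - f v ∣ + hamming u v
Gn-radio-gap D≥3 (_ , radio) u≢v = ≤-trans (+-monoˡ-≤ 1 D≥3) (radio _ _ u≢v _ (K□K□K-isDist _ _))

mainTheorem12 : (n : ℕ) → 2 ≤ n → (D : ℕ) → IsDiam (Gn n) D →
    (f : V (Gn n) → ℕ) → IsRadioLabeling (Gn n) D f →
    (s : ℕ) → IsSpan (Gn n) f s → 6 * n ∸ 1 ≤ s
mainTheorem12 n 2≤n D diam f f-radio s span =
  ∸-monoˡ-≤ 1 (RadioLabelingOfGn.span-bound f (proj₁ f-radio) (Gn-radio-gap (Gn-diam≥3 2≤n diam) f-radio) span)
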